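{- Let $n\ge1$. The average number of ascents of an element of $\overline{\mathcal{Q}}_n$ is $(3n+1)/4$, the average number of descents is $(3n+1)/4$, and the average number of plateaus is $(n+1)/2$.
   Context: For a sequence $\pi=\pi_1\cdots\pi_r$: $i\in\{1,\dots,r\}$ is a descent if $\pi_i>\pi_{i+1}$ or $i=r$; $i\in\{0,\dots,r-1\}$ is an ascent if $\pi_i<\pi_{i+1}$ or $i=0$; $i\in\{1,\dots,r-1\}$ is a plateau if $\pi_i=\pi_{i+1}$. $\overline{\mathcal{Q}}_n$ is the set of quasi-Stirling permutations: permutations $\pi_1\cdots\pi_{2n}$ of the multiset $\{1,1,\dots,n,n\}$ with no indices $i<j<k<\ell$ such that $\pi_i=\pi_k$ and $\pi_j=\pi_\ell$. Averages are over the uniform distribution on $\overline{\mathcal{Q}}_n$. -}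

module Defs where

open import Data.Nat using (ℕ; zero; suc; _+_; _*_; _≡ᵇ_; _<ᵇ_)
open import Data.Bool using (Bool; true; false; _∧_; if_then_else_)
open import Data.List using (List; []; _∷_; map; concatMap; filter; length; upTo)
open import Data.Bool.ListAction using (all; any)
open import Data.Nat.ListAction using (sum)
open import Relation.Nullary.Decidable using (does)
open import Data.Bool.Properties using (T?)

words : ℕ → ℕ → List (List ℕ)
words n zero    = [] ∷ []
words n (suc k) = concatMap (λ a → map (a ∷_) (words n k)) (map suc (upTo n))

-- 0-indexed lookup with default 0 (only used on valid indices)
nth : List ℕ → ℕ → ℕ
nth []       _       = 0
nth (x ∷ xs) zero    = x
nth (x ∷ xs) (suc i) = nth xs i

occ : ℕ → List ℕ → ℕ
occ v []       = 0
occ v (x ∷ xs) = (if v ≡ᵇ x then 1 else 0) + occ v xs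

-- w is a permutation of the multiset {1,1,2,2,…,n,n}
-- (given that w has letters in {1..n}: each value 1..n occurs exactly twice)
isMultisetPerm : ℕ → List ℕ → Bool
isMultisetPerm n w = (length w ≡ᵇ (2 * n)) ∧ all (λ v → occ (suc v) w ≡ᵇ 2) (upTo n)

has1212 : List ℕ → Bool
has1212 w =
  any (λ i → any (λ j → any (λ k → any (λ l →
        (i <ᵇ j) ∧ (j <ᵇ k) ∧ (k <ᵇ l)
        ∧ (nth w i ≡ᵇ nth w k) ∧ (nth w j ≡ᵇ nth w l))
      r) r) r) r
  where r = upTo (length w)

not : Bool → Bool
not true  = false
not false = true

isQuasiStirling : ℕ → List ℕ → Bool
isQuasiStirling n w = isMultisetPerm n w ∧ not (has1212 w)

-- the set  Q̄ₙ  of quasi-Stirling permutations of {1,1,…,n,n} (as a duplicate-free list)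
QS : ℕ → List (List ℕ)
QS n = filter (λ w → T? (isQuasiStirling n w)) (words n (2 * n))

countAdj : (ℕ → ℕ → Bool) → List ℕ → ℕ
countAdj R []           = 0
countAdj R (x ∷ [])     = 0
countAdj R (x ∷ y ∷ xs) = (if R x y then 1 else 0) + countAdj R (y ∷ xs)

-- ascents: i = 0 always, plus i ∈ {1..r-1} with π_i < π_{i+1}   (r ≥ 1)
asc : List ℕ → ℕ
asc []      = 0
asc w@(_ ∷ _) = suc (countAdj _<ᵇ_ w)

-- descents: i = r always, plus i ∈ {1..r-1} with π_i > π_{i+1}   (r ≥ 1)
des : List ℕ → ℕ
des []      = 0
des w@(_ ∷ _) = suc (countAdj (λ a b → b <ᵇ a) w)

plat : List ℕ → ℕ
plat = countAdj _≡ᵇ_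

total : (List ℕ → ℕ) → ℕ → ℕ
total f n = sum (map f (QS n))

card : ℕ → ℕ
card n = length (QS n)

-- Quasi-Stirling permutations are exactly the nested words: a u a v with u, v nested on
-- disjoint alphabets avoiding a, i.e. plane binary trees on n labelled nodes (root a, left
-- subtree u, right subtree v).  The complement x ↦ n + 1 ∸ x is an involution of Q̄ₙ that
-- exchanges ascents and descents.  A plateau aa is a node with empty left subtree, so under the
-- involution mirroring every node, a u a v ↦ a v′ a u′, each of the n + 1 empty subtrees is a
-- plateau of exactly one of w and its mirror image.  Finally asc + des + plat = 2n + 1 on every
-- word of length 2n, and averaging these three facts over Q̄ₙ gives the claim.

module Submission where

open import Defs
open import Data.Nat using (ℕ; _+_; _*_; _≤_)
open import Data.Product using (_×_)
open import Relation.Binary.PropositionalEquality using (_≡_)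

open import Data.Bool using (Bool; true; false; T; _∧_; if_then_else_)
open import Data.Bool.ListAction using (any; all)
open import Data.Bool.Properties using (T?; T-≡; T-∧; ⇔→≡)
open import Data.Empty using (⊥; ⊥-elim)
open import Data.List using (List; []; _∷_; _++_; map; length; drop; upTo; concatMap; cartesianProductWith)
open import Data.List.Membership.Propositional using (_∈_; _∉_; find; lose)
open import Data.List.Membership.Propositional.Properties
  using (∈-∃++; ∈-++⁺ˡ; ∈-++⁺ʳ; ∈-map⁺; ∈-map⁻; ∈-upTo⁺; ∈-upTo⁻; ∈-filter⁺; ∈-filter⁻;
         ∈-cartesianProductWith⁺; ∈-cartesianProductWith⁻)
open import Data.List.Membership.Propositional.Properties.WithK using (unique∧set⇒bag)
open import Data.List.Properties using (length-++; length-map; map-++; map-∘; map-cong-local)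
open import Data.List.Relation.Binary.BagAndSetEquality using (_∼[_]_; set; ∼bag⇒↭)
open import Data.List.Relation.Binary.Disjoint.Propositional using (Disjoint)
open import Data.List.Relation.Binary.Permutation.Propositional as Perm
  using (_↭_; ↭-refl; ↭-prep; ↭-trans; ↭-sym)
import Data.List.Relation.Binary.Permutation.Propositional.Properties as ↭
open import Data.List.Relation.Binary.Sublist.Propositional
  using (_⊆_; []; _∷_; _∷ʳ_; lookup; minimum; from∈; ⊆-refl; ⊆-trans)
open import Data.List.Relation.Binary.Sublist.Propositional.Properties
  using (∷⁻; ++⁺ˡ; ++⁺ʳ; ++⁺; length-mono-≤; drop⁺-≥; drop-⊆)
open import Data.List.Relation.Unary.All using (All; []; _∷_)
import Data.List.Relation.Unary.All as All
open import Data.List.Relation.Unary.All.Properties using (++⁻; all⁺; all⁻)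
import Data.List.Relation.Unary.All.Properties as All
open import Data.List.Relation.Unary.Any using (here; there)
open import Data.List.Relation.Unary.Any.Properties using (any⁺; any⁻)
open import Data.List.Relation.Unary.Unique.Propositional using (Unique; []; _∷_)
import Data.List.Relation.Unary.Unique.Propositional.Properties as Unique
open import Data.Nat using (zero; suc; _∸_; _<_; _≡ᵇ_; _<ᵇ_; _≟_; z≤n; s≤s)
open import Data.List.Membership.DecPropositional _≟_ using (_∈?_)
open import Data.Nat.ListAction using (sum)
open import Data.Nat.ListAction.Properties using (sum-↭)
open import Data.Nat.Properties
open import Algebra.Properties.CommutativeSemigroup +-commutativeSemigroup using (x∙yz≈y∙xz; interchange)
open import Data.Nat.Tactic.RingSolver using (solve-∀)
open import Data.Product using (∃; ∃₂; _,_; map₁)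
open import Function using (Equivalence; _⇔_; mk⇔; _∘_; _∘′_)
open import Relation.Binary.PropositionalEquality
  using (refl; sym; trans; cong; cong₂; subst; subst₂; _≢_; module ≡-Reasoning)
open import Relation.Nullary using (¬_; yes; no)

≡ᵇ-refl : ∀ x → (x ≡ᵇ x) ≡ true
≡ᵇ-refl x = Equivalence.to T-≡ (≡⇒≡ᵇ x x refl)

≢⇒≡ᵇ-false : ∀ {x y} → x ≢ y → (x ≡ᵇ y) ≡ false
≢⇒≡ᵇ-false {x} {y} x≢y with x ≡ᵇ y in eq
... | true  = ⊥-elim (x≢y (≡ᵇ⇒≡ x y (Equivalence.from T-≡ eq)))
... | false = refl

<ᵇ≡true⇔< : ∀ {m n} → (m <ᵇ n) ≡ true ⇔ m < n
<ᵇ≡true⇔< {m} {n} = mk⇔ (<ᵇ⇒< m n ∘ Equivalence.from T-≡) (Equivalence.to T-≡ ∘ <⇒<ᵇ)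

T-not : ∀ {b} → T (not b) ⇔ (¬ T b)
T-not {true}  = mk⇔ (λ ()) (λ ¬t → ¬t _)
T-not {false} = mk⇔ (λ _ ()) _

any-witness : ∀ (p : ℕ → Bool) xs → T (any p xs) → ∃ λ x → x ∈ xs × T (p x)
any-witness p xs = find ∘ any⁻ p xs

any-intro : ∀ (p : ℕ → Bool) {xs x} → x ∈ xs → T (p x) → T (any p xs)
any-intro p x∈xs px = any⁺ p (lose x∈xs px)

occ-++ : ∀ x u v → occ x (u ++ v) ≡ occ x u + occ x v
occ-++ x []      v = refl
occ-++ x (y ∷ u) v = trans (cong (_ +_) (occ-++ x u v)) (sym (+-assoc _ (occ x u) (occ x v)))

occ-here : ∀ x r → occ x (x ∷ r) ≡ suc (occ x r)
occ-here x r rewrite ≡ᵇ-refl x = refl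

occ-there : ∀ {x y} r → x ≢ y → occ x (y ∷ r) ≡ occ x r
occ-there r x≢y rewrite ≢⇒≡ᵇ-false x≢y = refl

∉⇒occ≡0 : ∀ {x} r → x ∉ r → occ x r ≡ 0
∉⇒occ≡0 []      _   = refl
∉⇒occ≡0 (y ∷ r) x∉r = trans (occ-there r (x∉r ∘′ here)) (∉⇒occ≡0 r (x∉r ∘′ there))

∈⇒occ≢0 : ∀ {x r} → x ∈ r → occ x r ≢ 0
∈⇒occ≢0 {x} (here refl) rewrite ≡ᵇ-refl x = λ ()
∈⇒occ≢0 {x} {y ∷ r} (there x∈r) with x ≡ᵇ y
... | true  = λ ()
... | false = ∈⇒occ≢0 x∈r

occ-↭ : ∀ x {u v} → u ↭ v → occ x u ≡ occ x v
occ-↭ x Perm.refl         = refl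
occ-↭ x (Perm.prep y p)   = cong (_ +_) (occ-↭ x p)
occ-↭ x {_ ∷ _ ∷ xs} (Perm.swap y z p) =
  trans (x∙yz≈y∙xz (δ y) (δ z) (occ x xs)) (cong (λ n → δ z + (δ y + n)) (occ-↭ x p))
  where
  δ : ℕ → ℕ
  δ b = if x ≡ᵇ b then 1 else 0
occ-↭ x (Perm.trans p q)  = trans (occ-↭ x p) (occ-↭ x q)

data Nested : List ℕ → Set where
  []   : Nested []
  node : ∀ {a u v} → a ∉ u → a ∉ v → Disjoint u v → Nested u → Nested v →
         Nested (a ∷ u ++ a ∷ v)

Avoids1212 : List ℕ → Set
Avoids1212 w = ∀ x y → x ∷ y ∷ x ∷ y ∷ [] ⊆ w → ⊥

⊆-++-split : ∀ {p : List ℕ} u {t} → p ⊆ u ++ t → ∃₂ λ p₁ p₂ → p₁ ++ p₂ ≡ p × p₁ ⊆ u × p₂ ⊆ t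
⊆-++-split []      σ        = [] , _ , refl , minimum _ , σ
⊆-++-split (x ∷ u) (x ∷ʳ σ) with ⊆-++-split u σ
... | p₁ , p₂ , refl , σ₁ , σ₂ = p₁ , p₂ , refl , x ∷ʳ σ₁ , σ₂
⊆-++-split (x ∷ u) (refl ∷ σ) with ⊆-++-split u σ
... | p₁ , p₂ , refl , σ₁ , σ₂ = x ∷ p₁ , p₂ , refl , refl ∷ σ₁ , σ₂

Nested⇒Avoids1212 : ∀ {w} → Nested w → Avoids1212 w
Nested⇒Avoids1212 [] x y ()
Nested⇒Avoids1212 (node {a} {u} {v} a∉u a∉v u#v nu nv) x y = avoid
  where
  apart : ∀ {p q z} → p ⊆ u → q ⊆ a ∷ v → z ∈ p → z ∈ q → ⊥
  apart σ τ z∈p z∈q with lookup τ z∈q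
  ... | here refl = a∉u (lookup σ z∈p)
  ... | there z∈v = u#v (lookup σ z∈p , z∈v)

  a∉tail : ∀ {b q} → b ∷ q ⊆ a ∷ v → a ∉ q
  a∉tail τ a∈q = a∉v (lookup (∷⁻ τ) a∈q)

  -- Unless the first x is the root a, the occurrence splits as p₁ ⊆ u, p₂ ⊆ a ∷ v, and every
  -- proper split of xyxy shares a letter, which cannot lie in both u and a ∷ v.
  avoid : x ∷ y ∷ x ∷ y ∷ [] ⊆ a ∷ u ++ a ∷ v → ⊥
  avoid (refl ∷ σ) with ⊆-++-split u {a ∷ v} σ
  ... | []                    , _ , refl , _ , τ = a∉tail τ (here refl)
  ... | _ ∷ []                , _ , refl , σ , τ = apart σ τ (here refl) (there (here refl))
  ... | _ ∷ _ ∷ []            , _ , refl , σ , _ = a∉u (lookup σ (there (here refl)))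
  ... | _ ∷ _ ∷ _ ∷ []        , _ , refl , σ , _ = a∉u (lookup σ (there (here refl)))
  ... | _ ∷ _ ∷ _ ∷ _ ∷ _     , _ , ()   , _ , _
  avoid (_ ∷ʳ σ) with ⊆-++-split u {a ∷ v} σ
  ... | []                    , _ , refl , _ , τ@(refl ∷ _) = a∉tail τ (there (here refl))
  ... | []                    , _ , refl , _ , _ ∷ʳ τ = Nested⇒Avoids1212 nv x y τ
  ... | _ ∷ []                , _ , refl , σ , τ = apart σ τ (here refl) (there (here refl))
  ... | _ ∷ _ ∷ []            , _ , refl , σ , τ = apart σ τ (here refl) (here refl)
  ... | _ ∷ _ ∷ _ ∷ []        , _ , refl , σ , τ = apart σ τ (there (here refl)) (here refl)
  ... | _ ∷ _ ∷ _ ∷ _ ∷ []    , _ , refl , σ , _ = Nested⇒Avoids1212 nu x y σ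
  ... | _ ∷ _ ∷ _ ∷ _ ∷ _ ∷ _ , _ , ()   , _ , _

TwiceEach : List ℕ → Set
TwiceEach w = ∀ {x} → x ∈ w → occ x w ≡ 2

occ-node : ∀ {x a} u v → x ≢ a → occ x (a ∷ u ++ a ∷ v) ≡ occ x u + occ x v
occ-node {x} {a} u v x≢a = begin
  occ x (a ∷ u ++ a ∷ v)    ≡⟨ occ-there (u ++ a ∷ v) x≢a ⟩
  occ x (u ++ a ∷ v)        ≡⟨ occ-++ x u (a ∷ v) ⟩
  occ x u + occ x (a ∷ v)   ≡⟨ cong (occ x u +_) (occ-there v x≢a) ⟩
  occ x u + occ x v         ∎
  where open ≡-Reasoning

split-at-unique : ∀ a r → occ a r ≡ 1 → ∃₂ λ u v → r ≡ u ++ a ∷ v × a ∉ u × a ∉ v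
split-at-unique a r once with a ∈? r
... | no a∉r  = ⊥-elim (0≢1+n (trans (sym (∉⇒occ≡0 r a∉r)) once))
... | yes a∈r with ∈-∃++ a∈r
... | u , v , refl = u , v , refl , (λ a∈u → ∈⇒occ≢0 a∈u (m+n≡0⇒m≡0 _ no-other))
                                , (λ a∈v → ∈⇒occ≢0 a∈v (m+n≡0⇒n≡0 (occ a u) no-other))
  where
  no-other : occ a u + occ a v ≡ 0
  no-other = suc-injective (begin
    suc (occ a u + occ a v)      ≡⟨ +-suc (occ a u) (occ a v) ⟨
    occ a u + suc (occ a v)      ≡⟨ cong (occ a u +_) (occ-here a v) ⟨
    occ a u + occ a (a ∷ v)      ≡⟨ occ-++ a u (a ∷ v) ⟨
    occ a (u ++ a ∷ v)           ≡⟨ once ⟩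
    1                            ∎)
    where open ≡-Reasoning

Avoids1212-⊆ : ∀ {w w′} → w ⊆ w′ → Avoids1212 w′ → Avoids1212 w
Avoids1212-⊆ σ avoids x y τ = avoids x y (⊆-trans τ σ)

module _ {a : ℕ} (u v : List ℕ) where

  ⊆-left : u ⊆ u ++ a ∷ v
  ⊆-left = ++⁺ʳ (a ∷ v) ⊆-refl

  ⊆-right : v ⊆ u ++ a ∷ v
  ⊆-right = ++⁺ˡ u (a ∷ʳ ⊆-refl)

nested-by-fuel : ∀ k {w} → length w ≤ k → TwiceEach w → Avoids1212 w → Nested w
nested-by-fuel _       {[]}    _           _     _      = []
nested-by-fuel (suc k) {a ∷ r} (s≤s |r|≤k) twice avoids
  with split-at-unique a r (suc-injective (trans (sym (occ-here a r)) (twice (here refl))))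
... | u , v , refl , a∉u , a∉v =
  node a∉u a∉v u#v
    (nested-by-fuel k (≤-trans (length-mono-≤ (⊆-left u v)) |r|≤k) twice-u
       (Avoids1212-⊆ (a ∷ʳ ⊆-left u v) avoids))
    (nested-by-fuel k (≤-trans (length-mono-≤ (⊆-right u v)) |r|≤k) twice-v
       (Avoids1212-⊆ (a ∷ʳ ⊆-right u v) avoids))
  where
  u#v : Disjoint u v
  u#v (x∈u , x∈v) = avoids a _ (refl ∷ ++⁺ (from∈ x∈u) (refl ∷ from∈ x∈v))
  twice-u : TwiceEach u
  twice-u {x} x∈u = begin
    occ x u                  ≡⟨ +-identityʳ _ ⟨
    occ x u + 0              ≡⟨ cong (occ x u +_) (∉⇒occ≡0 v (λ x∈v → u#v (x∈u , x∈v))) ⟨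
    occ x u + occ x v        ≡⟨ occ-node u v (λ { refl → a∉u x∈u }) ⟨
    occ x (a ∷ u ++ a ∷ v)   ≡⟨ twice (there (∈-++⁺ˡ x∈u)) ⟩
    2                        ∎
    where open ≡-Reasoning
  twice-v : TwiceEach v
  twice-v {x} x∈v = begin
    occ x v                  ≡⟨ cong (_+ occ x v) (∉⇒occ≡0 u (λ x∈u → u#v (x∈u , x∈v))) ⟨
    occ x u + occ x v        ≡⟨ occ-node u v (λ { refl → a∉v x∈v }) ⟨
    occ x (a ∷ u ++ a ∷ v)   ≡⟨ twice (there (∈-++⁺ʳ u (there x∈v))) ⟩
    2                        ∎
    where open ≡-Reasoning

TwiceEach∧Avoids1212⇒Nested : ∀ {w} → TwiceEach w → Avoids1212 w → Nested w
TwiceEach∧Avoids1212⇒Nested {w} = nested-by-fuel (length w) ≤-refl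

breakAt : ℕ → List ℕ → List ℕ × List ℕ
breakAt a []      = [] , []
breakAt a (x ∷ r) = if a ≡ᵇ x then ([] , r) else map₁ (x ∷_) (breakAt a r)

breakAt-++ : ∀ {a} u v → a ∉ u → breakAt a (u ++ a ∷ v) ≡ (u , v)
breakAt-++ {a} []      v _   rewrite ≡ᵇ-refl a = refl
breakAt-++ {a} (x ∷ u) v a∉u rewrite ≢⇒≡ᵇ-false (a∉u ∘′ here) | breakAt-++ u v (a∉u ∘′ there) = refl

-- The recursive calls are on the two factors returned by breakAt, so the length is passed as fuel.
mirrorFuel : ℕ → List ℕ → List ℕ
mirrorFuel _       []      = []
mirrorFuel zero    (_ ∷ _) = []
mirrorFuel (suc k) (a ∷ r) = let u , v = breakAt a r in a ∷ mirrorFuel k v ++ a ∷ mirrorFuel k u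

mirror : List ℕ → List ℕ
mirror w = mirrorFuel (length w) w

mirrorFuel-irrelevant : ∀ {w} → Nested w → ∀ {k l} → length w ≤ k → length w ≤ l →
                        mirrorFuel k w ≡ mirrorFuel l w
mirrorFuel-irrelevant [] _ _ = refl
mirrorFuel-irrelevant (node {a} {u} {v} a∉u _ _ nu nv) {suc k} {suc l} (s≤s p) (s≤s q)
  rewrite breakAt-++ u v a∉u =
  cong₂ (λ v′ u′ → a ∷ v′ ++ a ∷ u′)
    (mirrorFuel-irrelevant nv (≤-trans (length-mono-≤ (⊆-right u v)) p) (≤-trans (length-mono-≤ (⊆-right u v)) q))
    (mirrorFuel-irrelevant nu (≤-trans (length-mono-≤ (⊆-left u v)) p) (≤-trans (length-mono-≤ (⊆-left u v)) q))

mirror-node : ∀ {a u v} → a ∉ u → Nested u → Nested v → mirror (a ∷ u ++ a ∷ v) ≡ a ∷ mirror v ++ a ∷ mirror u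
mirror-node {a} {u} {v} a∉u nu nv rewrite breakAt-++ u v a∉u =
  cong₂ (λ v′ u′ → a ∷ v′ ++ a ∷ u′)
    (mirrorFuel-irrelevant nv (length-mono-≤ (⊆-right u v)) ≤-refl)
    (mirrorFuel-irrelevant nu (length-mono-≤ (⊆-left u v)) ≤-refl)

mirror-↭ : ∀ {w} → Nested w → mirror w ↭ w
mirror-↭ [] = ↭-refl
mirror-↭ (node {a} {u} {v} a∉u _ _ nu nv) rewrite mirror-node a∉u nu nv =
  ↭-prep a (↭-trans (↭.++⁺ (mirror-↭ nv) (↭-prep a (mirror-↭ nu)))
           (↭-trans (↭.++-comm v (a ∷ u)) (↭-sym (↭.shift a u v))))

∈-mirror : ∀ {w x} → Nested w → x ∈ mirror w → x ∈ w
∈-mirror nw = ↭.∈-resp-↭ (mirror-↭ nw)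

Nested-mirror : ∀ {w} → Nested w → Nested (mirror w)
Nested-mirror [] = []
Nested-mirror (node a∉u a∉v u#v nu nv) rewrite mirror-node a∉u nu nv =
  node (a∉v ∘′ ∈-mirror nv) (a∉u ∘′ ∈-mirror nu)
       (λ (x∈v , x∈u) → u#v (∈-mirror nu x∈u , ∈-mirror nv x∈v))
       (Nested-mirror nv) (Nested-mirror nu)

mirror-involutive : ∀ {w} → Nested w → mirror (mirror w) ≡ w
mirror-involutive [] = refl
mirror-involutive (node {a} {u} {v} a∉u a∉v u#v nu nv) = begin
  mirror (mirror (a ∷ u ++ a ∷ v))                 ≡⟨ cong mirror (mirror-node a∉u nu nv) ⟩
  mirror (a ∷ mirror v ++ a ∷ mirror u)            ≡⟨ mirror-node (a∉v ∘′ ∈-mirror nv) (Nested-mirror nv) (Nested-mirror nu) ⟩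
  a ∷ mirror (mirror u) ++ a ∷ mirror (mirror v)   ≡⟨ cong₂ (λ u′ v′ → a ∷ u′ ++ a ∷ v′) (mirror-involutive nu) (mirror-involutive nv) ⟩
  a ∷ u ++ a ∷ v                                   ∎
  where open ≡-Reasoning

emptyIndicator : List ℕ → ℕ
emptyIndicator []      = 1
emptyIndicator (_ ∷ _) = 0

emptyIndicator-mirror : ∀ w → emptyIndicator (mirror w) ≡ emptyIndicator w
emptyIndicator-mirror []      = refl
emptyIndicator-mirror (_ ∷ _) = refl

plat-∷-∉ : ∀ {x} ys → x ∉ ys → plat (x ∷ ys) ≡ plat ys
plat-∷-∉ []      _    = refl
plat-∷-∉ (y ∷ _) x∉ys rewrite ≢⇒≡ᵇ-false (x∉ys ∘′ here) = refl

plat-++-∷ : ∀ {a} u v → a ∉ u → plat (u ++ a ∷ v) ≡ plat u + plat (a ∷ v)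
plat-++-∷ []          v _   = refl
plat-++-∷ (b ∷ [])    v a∉u rewrite ≢⇒≡ᵇ-false (λ b≡a → a∉u (here (sym b≡a))) = refl
plat-++-∷ {a} (b ∷ c ∷ u) v a∉u =
  trans (cong (_ +_) (plat-++-∷ (c ∷ u) v (a∉u ∘′ there)))
        (sym (+-assoc (if b ≡ᵇ c then 1 else 0) (plat (c ∷ u)) (plat (a ∷ v))))

plat-node : ∀ {a u v} → a ∉ u → a ∉ v → plat (a ∷ u ++ a ∷ v) ≡ emptyIndicator u + plat u + plat v
plat-node {a} {[]}    {v} _   a∉v rewrite ≡ᵇ-refl a = cong suc (plat-∷-∉ v a∉v)
plat-node {a} {b ∷ u} {v} a∉u a∉v
  rewrite ≢⇒≡ᵇ-false (a∉u ∘′ here) | plat-++-∷ (b ∷ u) v a∉u | plat-∷-∉ v a∉v = refl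

plat+plat-mirror : ∀ {w} → Nested w →
  2 * (plat w + plat (mirror w) + emptyIndicator w) ≡ length w + 2
plat+plat-mirror [] = refl
plat+plat-mirror (node {a} {u} {v} a∉u a∉v u#v nu nv)
  rewrite mirror-node a∉u nu nv
        | plat-node a∉u a∉v
        | plat-node (a∉v ∘′ ∈-mirror nv) (a∉u ∘′ ∈-mirror nu)
        | emptyIndicator-mirror v
        | length-++ u {a ∷ v} =
  trans (regroup (emptyIndicator u) (plat u) (plat v) (emptyIndicator v) (plat (mirror v)) (plat (mirror u)))
        (trans (cong₂ _+_ (plat+plat-mirror nu) (plat+plat-mirror nv)) (count (length u) (length v)))
  where
  regroup : ∀ a b c d e f → 2 * ((a + b + c) + (d + e + f) + 0) ≡ 2 * (b + f + a) + 2 * (c + e + d)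
  regroup = solve-∀
  count : ∀ m n → (m + 2) + (n + 2) ≡ suc (m + suc n) + 2
  count = solve-∀

module _ {P : ℕ → Set} (f : ℕ → ℕ) (f-injective : ∀ {x y} → P x → P y → f x ≡ f y → x ≡ y) where

  ∉-map : ∀ {a u} → P a → All P u → a ∉ u → f a ∉ map f u
  ∉-map {u = _ ∷ _} pa (px ∷ _)   a∉u (here fa≡fx) = a∉u (here (f-injective pa px fa≡fx))
  ∉-map {u = _ ∷ _} pa (_  ∷ pu) a∉u (there fa∈u) = ∉-map pa pu (a∉u ∘′ there) fa∈u

  Nested-map : ∀ {w} → Nested w → All P w → Nested (map f w)
  Nested-map [] _ = []
  Nested-map (node {a} {u} {v} a∉u a∉v u#v nu nv) (pa ∷ pw) with ++⁻ u pw
  ... | pu , (_ ∷ pv) rewrite map-++ f u (a ∷ v) =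
    node (∉-map pa pu a∉u) (∉-map pa pv a∉v) apart (Nested-map nu pu) (Nested-map nv pv)
    where
    apart : Disjoint (map f u) (map f v)
    apart (fx∈u , fx∈v) with ∈-map⁻ f fx∈u | ∈-map⁻ f fx∈v
    ... | x , x∈u , refl | y , y∈v , fx≡fy =
      u#v (x∈u , subst (_∈ v) (sym (f-injective (All.lookup pu x∈u) (All.lookup pv y∈v) fx≡fy)) y∈v)

  occ-map : ∀ {x} w → P x → All P w → occ (f x) (map f w) ≡ occ x w
  occ-map         []      _  _         = refl
  occ-map {x} (y ∷ w) px (py ∷ pw) with x ≟ y
  ... | yes refl rewrite ≡ᵇ-refl x | ≡ᵇ-refl (f x) = cong suc (occ-map w px pw)
  ... | no x≢y   rewrite ≢⇒≡ᵇ-false x≢y | ≢⇒≡ᵇ-false (x≢y ∘′ f-injective px py) = occ-map w px pw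

countAdj-map : ∀ {P : ℕ → Set} {R S : ℕ → ℕ → Bool} (f : ℕ → ℕ) →
  (∀ {x y} → P x → P y → R (f x) (f y) ≡ S x y) →
  ∀ {w} → All P w → countAdj R (map f w) ≡ countAdj S w
countAdj-map f R≡S []               = refl
countAdj-map f R≡S (_ ∷ [])         = refl
countAdj-map f R≡S (px ∷ py ∷ pw) =
  cong₂ (λ b n → (if b then 1 else 0) + n) (R≡S px py) (countAdj-map f R≡S (py ∷ pw))

<ᵇ-∸-flip : ∀ {m x y} → x ≤ m → (m ∸ x <ᵇ m ∸ y) ≡ (y <ᵇ x)
<ᵇ-∸-flip {m} {x} {y} x≤m = ⇔→≡ {z = true} (mk⇔
  (from (<ᵇ≡true⇔< {y} {x}) ∘ ∸-cancelʳ-< ∘ to (<ᵇ≡true⇔< {m ∸ x} {m ∸ y}))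
  (from (<ᵇ≡true⇔< {m ∸ x} {m ∸ y}) ∘ (λ y<x → ∸-monoʳ-< y<x x≤m) ∘ to (<ᵇ≡true⇔< {y} {x})))
  where open Equivalence

Letter : ℕ → ℕ → Set
Letter n x = 1 ≤ x × x ≤ n

complement : ℕ → List ℕ → List ℕ
complement n = map (suc n ∸_)

module _ {n : ℕ} where

  Letter⇒≤ : ∀ {x} → Letter n x → x ≤ suc n
  Letter⇒≤ (_ , x≤n) = m≤n⇒m≤1+n x≤n

  Letter-∸ : ∀ {x} → Letter n x → Letter n (suc n ∸ x)
  Letter-∸ (1≤x , x≤n) = m<n⇒0<n∸m (s≤s x≤n) , ∸-monoʳ-≤ (suc n) 1≤x

  ∸-involutive : ∀ {x} → Letter n x → suc n ∸ (suc n ∸ x) ≡ x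
  ∸-involutive = m∸[m∸n]≡n ∘ Letter⇒≤

  ∸-injective : ∀ {x y} → Letter n x → Letter n y → suc n ∸ x ≡ suc n ∸ y → x ≡ y
  ∸-injective lx ly = ∸-cancelˡ-≡ (Letter⇒≤ lx) (Letter⇒≤ ly)

  complement-involutive : ∀ {w} → All (Letter n) w → complement n (complement n w) ≡ w
  complement-involutive []        = refl
  complement-involutive (lx ∷ lw) = cong₂ _∷_ (∸-involutive lx) (complement-involutive lw)

  asc-complement : ∀ {w} → All (Letter n) w → asc (complement n w) ≡ des w
  asc-complement []          = refl
  asc-complement lw@(_ ∷ _) = cong suc (countAdj-map (suc n ∸_) (λ lx _ → <ᵇ-∸-flip (Letter⇒≤ lx)) lw)

<ᵇ+>ᵇ+≡ᵇ : ∀ x y → (if x <ᵇ y then 1 else 0) + (if y <ᵇ x then 1 else 0) + (if x ≡ᵇ y then 1 else 0) ≡ 1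
<ᵇ+>ᵇ+≡ᵇ zero    zero    = refl
<ᵇ+>ᵇ+≡ᵇ zero    (suc y) = refl
<ᵇ+>ᵇ+≡ᵇ (suc x) zero    = refl
<ᵇ+>ᵇ+≡ᵇ (suc x) (suc y) = <ᵇ+>ᵇ+≡ᵇ x y

asc+des+plat : ∀ x w → asc (x ∷ w) + des (x ∷ w) + plat (x ∷ w) ≡ suc (length (x ∷ w))
asc+des+plat x []      = refl
asc+des+plat x (y ∷ w) =
  trans (regroup (if x <ᵇ y then 1 else 0) (if y <ᵇ x then 1 else 0) (if x ≡ᵇ y then 1 else 0)
                 (countAdj _<ᵇ_ (y ∷ w)) (countAdj (λ a b → b <ᵇ a) (y ∷ w)) (plat (y ∷ w)))
        (cong₂ _+_ (<ᵇ+>ᵇ+≡ᵇ x y) (asc+des+plat y w))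
  where
  regroup : ∀ a b c d e f → suc (a + d) + suc (b + e) + (c + f) ≡ (a + b + c) + (suc d + suc e + f)
  regroup = solve-∀

nth-⊆ : ∀ {i} w {p} → i < length w → p ⊆ drop (suc i) w → nth w i ∷ p ⊆ drop i w
nth-⊆ {zero}  (_ ∷ _) _         σ = refl ∷ σ
nth-⊆ {suc i} (_ ∷ w) (s≤s i<) σ = nth-⊆ w i< σ

⊆-nth : ∀ m w {x p} → x ∷ p ⊆ drop m w →
        ∃ λ i → m ≤ i × i < length w × nth w i ≡ x × p ⊆ drop (suc i) w
⊆-nth zero    (_ ∷ _) (refl ∷ σ) = 0 , z≤n , s≤s z≤n , refl , σ
⊆-nth zero    (_ ∷ w) (_ ∷ʳ σ) with ⊆-nth zero w σ
... | i , _ , i< , eq , σ′ = suc i , z≤n , s≤s i< , eq , σ′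
⊆-nth (suc m) (_ ∷ w) σ with ⊆-nth m w σ
... | i , m≤i , i< , eq , σ′ = suc i , s≤s m≤i , s≤s i< , eq , σ′

nth-∷-⊆ : ∀ w {i j p} → i < j → i < length w → p ⊆ drop j w → nth w i ∷ p ⊆ drop i w
nth-∷-⊆ w i<j i<∣w∣ σ = nth-⊆ w i<∣w∣ (⊆-trans σ (drop⁺-≥ i<j))

indices-⊆ : ∀ w {i j k l} → i < j → j < k → k < l → l < length w →
            nth w i ∷ nth w j ∷ nth w k ∷ nth w l ∷ [] ⊆ w
indices-⊆ w {i} i<j j<k k<l l<∣w∣ =
  ⊆-trans (nth-∷-⊆ w i<j i<∣w∣ (nth-∷-⊆ w j<k j<∣w∣ (nth-∷-⊆ w k<l k<∣w∣ (nth-⊆ w l<∣w∣ (minimum _)))))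
          (drop-⊆ i w)
  where
  k<∣w∣ : _ < length w
  k<∣w∣ = <-trans k<l l<∣w∣
  j<∣w∣ : _ < length w
  j<∣w∣ = <-trans j<k k<∣w∣
  i<∣w∣ : i < length w
  i<∣w∣ = <-trans i<j j<∣w∣

pattern1212 : List ℕ → ℕ → ℕ → ℕ → ℕ → Bool
pattern1212 w i j k l = (i <ᵇ j) ∧ (j <ᵇ k) ∧ (k <ᵇ l) ∧ (nth w i ≡ᵇ nth w k) ∧ (nth w j ≡ᵇ nth w l)

positions : List ℕ → List ℕ
positions w = upTo (length w)

-- has1212 w unfolds to any ∃jkl (positions w).
module _ (w : List ℕ) where

  ∃l : ℕ → ℕ → ℕ → Bool
  ∃l i j k = any (pattern1212 w i j k) (positions w)

  ∃kl : ℕ → ℕ → Bool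
  ∃kl i j = any (∃l i j) (positions w)

  ∃jkl : ℕ → Bool
  ∃jkl i = any (∃kl i) (positions w)

  has1212-sound : T (has1212 w) → ∃₂ λ x y → x ∷ y ∷ x ∷ y ∷ [] ⊆ w
  has1212-sound t
    with i , _  , t ← any-witness ∃jkl (positions w) t
    with j , _  , t ← any-witness (∃kl i) (positions w) t
    with k , _  , t ← any-witness (∃l i j) (positions w) t
    with l , l∈ , t ← any-witness (pattern1212 w i j k) (positions w) t
    with i<j , t ← Equivalence.to T-∧ t
    with j<k , t ← Equivalence.to T-∧ t
    with k<l , t ← Equivalence.to T-∧ t
    with wi≡wk , wj≡wl ← Equivalence.to T-∧ t =
    nth w i , nth w j ,
    subst₂ (λ x y → nth w i ∷ nth w j ∷ x ∷ y ∷ [] ⊆ w)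
      (sym (≡ᵇ⇒≡ (nth w i) (nth w k) wi≡wk)) (sym (≡ᵇ⇒≡ (nth w j) (nth w l) wj≡wl))
      (indices-⊆ w (<ᵇ⇒< i j i<j) (<ᵇ⇒< j k j<k) (<ᵇ⇒< k l k<l) (∈-upTo⁻ l∈))

  has1212-complete : ∀ {x y} → x ∷ y ∷ x ∷ y ∷ [] ⊆ w → T (has1212 w)
  has1212-complete σ
    with i , _   , i<w , refl  , σ ← ⊆-nth 0 w σ
    with j , i<j , j<w , refl  , σ ← ⊆-nth (suc i) w σ
    with k , j<k , k<w , wk≡wi , σ ← ⊆-nth (suc j) w σ
    with l , k<l , l<w , wl≡wj , _ ← ⊆-nth (suc k) w σ =
    any-intro ∃jkl (∈-upTo⁺ i<w) (any-intro (∃kl i) (∈-upTo⁺ j<w)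
      (any-intro (∃l i j) (∈-upTo⁺ k<w) (any-intro (pattern1212 w i j k) (∈-upTo⁺ l<w)
        (∧-intro (<⇒<ᵇ i<j) (∧-intro (<⇒<ᵇ j<k) (∧-intro (<⇒<ᵇ k<l)
          (∧-intro (≡⇒≡ᵇ _ _ (sym wk≡wi)) (≡⇒≡ᵇ _ _ (sym wl≡wj)))))))))
    where
    ∧-intro : ∀ {a b} → T a → T b → T (a ∧ b)
    ∧-intro ta tb = Equivalence.from T-∧ (ta , tb)

words-suc : ∀ n k → words n (suc k) ≡ cartesianProductWith _∷_ (map suc (upTo n)) (words n k)
words-suc n k = go (map suc (upTo n))
  where
  go : ∀ xs → concatMap (λ a → map (a ∷_) (words n k)) xs ≡ cartesianProductWith _∷_ xs (words n k)
  go []       = refl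
  go (x ∷ xs) = cong (map (x ∷_) (words n k) ++_) (go xs)

Letter⇔∈ : ∀ {n x} → Letter n x ⇔ x ∈ map suc (upTo n)
Letter⇔∈ {n} = mk⇔ to from
  where
  to : ∀ {x} → Letter n x → x ∈ map suc (upTo n)
  to {suc x} (_ , x<n) = ∈-map⁺ suc (∈-upTo⁺ x<n)
  from : ∀ {x} → x ∈ map suc (upTo n) → Letter n x
  from x∈ with _ , y∈ , refl ← ∈-map⁻ suc x∈ = s≤s z≤n , ∈-upTo⁻ y∈

∈-words⁺ : ∀ {n w} → All (Letter n) w → w ∈ words n (length w)
∈-words⁺ []                  = here refl
∈-words⁺ {n} {x ∷ w} (lx ∷ lw) rewrite words-suc n (length w) =
  ∈-cartesianProductWith⁺ _∷_ (Equivalence.to Letter⇔∈ lx) (∈-words⁺ lw)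

∈-words⁻ : ∀ {n} k {w} → w ∈ words n k → length w ≡ k × All (Letter n) w
∈-words⁻ zero    (here refl) = refl , []
∈-words⁻ {n} (suc k) w∈ rewrite words-suc n k
  with x , w , x∈ , w∈ , refl ← ∈-cartesianProductWith⁻ _∷_ (map suc (upTo n)) (words n k) w∈
  with |w|≡k , lw ← ∈-words⁻ k w∈ = cong suc |w|≡k , Equivalence.from Letter⇔∈ x∈ ∷ lw

words-unique : ∀ n k → Unique (words n k)
words-unique n zero    = [] ∷ []
words-unique n (suc k) rewrite words-suc n k =
  Unique.cartesianProductWith⁺ _∷_ (λ { refl → refl , refl })
    (Unique.map⁺ suc-injective (Unique.upTo⁺ n)) (words-unique n k)

record QuasiStirling (n : ℕ) (w : List ℕ) : Set where
  field
    length≡ : length w ≡ 2 * n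
    letters : All (Letter n) w
    twice   : ∀ {v} → Letter n v → occ v w ≡ 2
    nested  : Nested w

twice⇔T-all : ∀ n w → (∀ {v} → Letter n v → occ v w ≡ 2) ⇔ T (all (λ v → occ (suc v) w ≡ᵇ 2) (upTo n))
twice⇔T-all n w = mk⇔
  (λ twice → all⁻ _ (All.tabulate λ v∈ → ≡⇒≡ᵇ _ 2 (twice (s≤s z≤n , ∈-upTo⁻ v∈))))
  (λ t → λ { {suc v} (_ , v<n) → ≡ᵇ⇒≡ _ 2 (All.lookup (all⁺ _ (upTo n) t) (∈-upTo⁺ v<n)) })

∈QS⇒QuasiStirling : ∀ n {w} → w ∈ QS n → QuasiStirling n w
∈QS⇒QuasiStirling n {w} w∈
  with w∈words , t ← ∈-filter⁻ (λ w → T? (isQuasiStirling n w)) w∈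
  with |w|≡ , letters ← ∈-words⁻ (2 * n) w∈words
  with perm , no1212 ← Equivalence.to T-∧ t
  with _ , all-twice ← Equivalence.to T-∧ perm =
  record
    { length≡ = |w|≡
    ; letters = letters
    ; twice   = twice
    ; nested  = TwiceEach∧Avoids1212⇒Nested (twice ∘′ All.lookup letters)
                  (λ x y σ → Equivalence.to T-not no1212 (has1212-complete w σ))
    }
  where
  twice : ∀ {v} → Letter n v → occ v w ≡ 2
  twice = Equivalence.from (twice⇔T-all n w) all-twice

QuasiStirling⇒∈QS : ∀ {n w} → QuasiStirling n w → w ∈ QS n
QuasiStirling⇒∈QS {n} {w} qs =
  ∈-filter⁺ (λ w → T? (isQuasiStirling n w))
    (subst (λ k → w ∈ words n k) length≡ (∈-words⁺ letters))
    (Equivalence.from T-∧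
      ( Equivalence.from T-∧ (≡⇒≡ᵇ _ _ length≡ , Equivalence.to (twice⇔T-all n w) twice)
      , Equivalence.from T-not (λ t → let x , y , σ = has1212-sound w t in Nested⇒Avoids1212 nested x y σ)))
  where open QuasiStirling qs

QS-unique : ∀ n → Unique (QS n)
QS-unique n = Unique.filter⁺ (λ w → T? (isQuasiStirling n w)) (words-unique n (2 * n))

module _ {n : ℕ} {w : List ℕ} (qs : QuasiStirling n w) where
  open QuasiStirling qs

  QuasiStirling-mirror : QuasiStirling n (mirror w)
  QuasiStirling-mirror = record
    { length≡ = trans (↭.↭-length (mirror-↭ nested)) length≡
    ; letters = ↭.All-resp-↭ (↭-sym (mirror-↭ nested)) letters
    ; twice   = λ {v} lv → trans (occ-↭ v (mirror-↭ nested)) (twice lv)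
    ; nested  = Nested-mirror nested
    }

  QuasiStirling-complement : QuasiStirling n (complement n w)
  QuasiStirling-complement = record
    { length≡ = trans (length-map (suc n ∸_) w) length≡
    ; letters = All.map⁺ (All.map Letter-∸ letters)
    ; twice   = λ {v} lv → begin
        occ v (complement n w)                           ≡⟨ cong (λ x → occ x (complement n w)) (∸-involutive lv) ⟨
        occ (suc n ∸ (suc n ∸ v)) (complement n w)       ≡⟨ occ-map (suc n ∸_) ∸-injective w (Letter-∸ lv) letters ⟩
        occ (suc n ∸ v) w                                ≡⟨ twice (Letter-∸ lv) ⟩
        2                                                ∎
    ; nested  = Nested-map (suc n ∸_) ∸-injective nested letters
    }
    where open ≡-Reasoning

module _ {A : Set} where

  Unique-map : ∀ (g : A → A) {L} → Unique L → (∀ {x y} → x ∈ L → y ∈ L → g x ≡ g y → x ≡ y) →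
               Unique (map g L)
  Unique-map g []          _   = []
  Unique-map g (x≢ ∷ uL) inj =
    All.map⁺ (All.tabulate λ y∈ gx≡gy → All.lookup x≢ y∈ (inj (here refl) (there y∈) gx≡gy))
    ∷ Unique-map g uL (λ x∈ y∈ → inj (there x∈) (there y∈))

  sum-map-involution : ∀ (f : A → ℕ) (g : A → A) {L} → Unique L →
    (∀ {x} → x ∈ L → g x ∈ L) → (∀ {x} → x ∈ L → g (g x) ≡ x) →
    sum (map (f ∘ g) L) ≡ sum (map f L)
  sum-map-involution f g {L} uL g∈ gg≡ = trans (cong sum (map-∘ L)) (sum-↭ (↭.map⁺ f gL↭L))
    where
    gL∼L : map g L ∼[ set ] L
    gL∼L = mk⇔ (λ y∈ → let x , x∈ , y≡gx = ∈-map⁻ g y∈ in subst (_∈ L) (sym y≡gx) (g∈ x∈))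
               (λ x∈ → subst (_∈ map g L) (gg≡ x∈) (∈-map⁺ g (g∈ x∈)))
    gL↭L : map g L ↭ L
    gL↭L = ∼bag⇒↭ (unique∧set⇒bag
      (Unique-map g uL (λ x∈ y∈ gx≡gy → trans (sym (gg≡ x∈)) (trans (cong g gx≡gy) (gg≡ y∈)))) uL gL∼L)

  sum-map-+ : ∀ (f g : A → ℕ) L → sum (map (λ x → f x + g x) L) ≡ sum (map f L) + sum (map g L)
  sum-map-+ f g []      = refl
  sum-map-+ f g (x ∷ L) = trans (cong (_ +_) (sum-map-+ f g L)) (interchange (f x) (g x) _ _)

  sum-map-const : ∀ (f : A → ℕ) {c} L → (∀ {x} → x ∈ L → f x ≡ c) → sum (map f L) ≡ length L * c
  sum-map-const f []      _    = refl
  sum-map-const f (x ∷ L) f≡c = cong₂ _+_ (f≡c (here refl)) (sum-map-const f L (f≡c ∘′ there))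

plat+plat-mirror-QS : ∀ {n w} → 1 ≤ n → QuasiStirling n w → plat w + plat (mirror w) ≡ n + 1
plat+plat-mirror-QS {suc _} {[]}    _ qs with () ← QuasiStirling.length≡ qs
plat+plat-mirror-QS {n}     {x ∷ r} _ qs = *-cancelˡ-≡ _ _ 2 (begin
  2 * (plat w + plat (mirror w))        ≡⟨ cong (2 *_) (+-identityʳ (plat w + plat (mirror w))) ⟨
  2 * (plat w + plat (mirror w) + 0)    ≡⟨ plat+plat-mirror (QuasiStirling.nested qs) ⟩
  length w + 2                          ≡⟨ cong (_+ 2) (QuasiStirling.length≡ qs) ⟩
  2 * n + 2                             ≡⟨ *-distribˡ-+ 2 n 1 ⟨
  2 * (n + 1)                           ∎)
  where
  open ≡-Reasoning
  w = x ∷ r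

asc+des+plat-QS : ∀ {n w} → 1 ≤ n → QuasiStirling n w → asc w + des w + plat w ≡ 2 * n + 1
asc+des+plat-QS {suc _} {[]}    _ qs with () ← QuasiStirling.length≡ qs
asc+des+plat-QS {n}     {x ∷ r} _ qs =
  trans (asc+des+plat x r) (trans (cong suc (QuasiStirling.length≡ qs)) (+-comm 1 (2 * n)))

module _ (n : ℕ) where

  total-cong : ∀ {f g : List ℕ → ℕ} → (∀ {w} → QuasiStirling n w → f w ≡ g w) → total f n ≡ total g n
  total-cong f≡g = cong sum (map-cong-local (All.tabulate (f≡g ∘′ ∈QS⇒QuasiStirling n)))

  total-+ : ∀ (f g : List ℕ → ℕ) → total (λ w → f w + g w) n ≡ total f n + total g n
  total-+ f g = sum-map-+ f g (QS n)

  total-const : ∀ {f : List ℕ → ℕ} {c} → (∀ {w} → QuasiStirling n w → f w ≡ c) → total f n ≡ card n * c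
  total-const f≡c = sum-map-const _ (QS n) (f≡c ∘′ ∈QS⇒QuasiStirling n)

  total-involution : ∀ (f : List ℕ → ℕ) (g : List ℕ → List ℕ) →
    (∀ {w} → QuasiStirling n w → QuasiStirling n (g w)) → (∀ {w} → QuasiStirling n w → g (g w) ≡ w) →
    total (f ∘ g) n ≡ total f n
  total-involution f g g-closed g-involutive = sum-map-involution f g (QS-unique n)
    (QuasiStirling⇒∈QS ∘′ g-closed ∘′ ∈QS⇒QuasiStirling n) (g-involutive ∘′ ∈QS⇒QuasiStirling n)

  total-asc≡total-des : total asc n ≡ total des n
  total-asc≡total-des = begin
    total asc n                  ≡⟨ total-involution asc (complement n) QuasiStirling-complement
                                      (complement-involutive ∘′ QuasiStirling.letters) ⟨
    total (asc ∘ complement n) n ≡⟨ total-cong (asc-complement ∘′ QuasiStirling.letters) ⟩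
    total des n                  ∎
    where open ≡-Reasoning

  module _ (1≤n : 1 ≤ n) where

    total-plat+total-plat : total plat n + total plat n ≡ card n * (n + 1)
    total-plat+total-plat = begin
      total plat n + total plat n                    ≡⟨ cong (total plat n +_) (total-involution plat mirror
                                                          QuasiStirling-mirror (mirror-involutive ∘′ QuasiStirling.nested)) ⟨
      total plat n + total (plat ∘ mirror) n         ≡⟨ total-+ plat (plat ∘ mirror) ⟨
      total (λ w → plat w + plat (mirror w)) n       ≡⟨ total-const (plat+plat-mirror-QS 1≤n) ⟩
      card n * (n + 1)                               ∎
      where open ≡-Reasoning

    total-asc+des+plat : total asc n + total des n + total plat n ≡ card n * (2 * n + 1)
    total-asc+des+plat = begin
      total asc n + total des n + total plat n       ≡⟨ cong (_+ total plat n) (total-+ asc des) ⟨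
      total (λ w → asc w + des w) n + total plat n   ≡⟨ total-+ (λ w → asc w + des w) plat ⟨
      total (λ w → asc w + des w + plat w) n         ≡⟨ total-const (asc+des+plat-QS 1≤n) ⟩
      card n * (2 * n + 1)                           ∎
      where open ≡-Reasoning

averages : ∀ n {a d p c : ℕ} → a ≡ d → p + p ≡ c * (n + 1) → a + d + p ≡ c * (2 * n + 1) →
           4 * a ≡ (3 * n + 1) * c × 4 * d ≡ (3 * n + 1) * c × 2 * p ≡ (n + 1) * c
averages n {a} {_} {p} {c} refl 2p≡ a+a+p≡ = 4a≡ , 4a≡ , trans (cong (p +_) (+-identityʳ p)) (trans 2p≡ (*-comm c (n + 1)))
  where
  open ≡-Reasoning
  double-sum : ∀ a p → 4 * a + (p + p) ≡ 2 * (a + a + p)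
  double-sum = solve-∀
  split-2[2n+1] : ∀ c n → 2 * (c * (2 * n + 1)) ≡ (3 * n + 1) * c + c * (n + 1)
  split-2[2n+1] = solve-∀
  4a≡ : 4 * a ≡ (3 * n + 1) * c
  4a≡ = +-cancelʳ-≡ (c * (n + 1)) _ _ (begin
    4 * a + c * (n + 1)              ≡⟨ cong (4 * a +_) 2p≡ ⟨
    4 * a + (p + p)                  ≡⟨ double-sum a p ⟩
    2 * (a + a + p)                  ≡⟨ cong (2 *_) a+a+p≡ ⟩
    2 * (c * (2 * n + 1))            ≡⟨ split-2[2n+1] c n ⟩
    (3 * n + 1) * c + c * (n + 1)    ∎)

corollary3p1 : (n : ℕ) → 1 ≤ n →
    (4 * total asc n ≡ (3 * n + 1) * card n)
    × (4 * total des n ≡ (3 * n + 1) * card n)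
    × (2 * total plat n ≡ (n + 1) * card n)
corollary3p1 n 1≤n =
  averages n (total-asc≡total-des n) (total-plat+total-plat n 1≤n) (total-asc+des+plat n 1≤n)
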